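{- Let $r<\frac{5}{3}$. There exists no deterministic $r$-competitive online algorithm for Online Makespan Scheduling under Scenarios with $m=2$ machines and $K=2$ scenarios that satisfies the following rule: whenever a job $j\in S_1\cap S_2$ is revealed, it is assigned to a machine $i\in\{1,2\}$ such that the makespan of the current schedule of jobs $1,\dots,j-1$ is attained by the other machine $3-i$; in case both machines attain this makespan, $j$ is assigned to the machine that received job $j-1$ (and to machine $1$ if $j=1$).
   Context: Online Makespan Scheduling under Scenarios with $m$ machines and $K$ scenarios (both known in advance): an instance consists of $n$ jobs with processing times $p_j\ge0$ and scenarios $S_1,\dots,S_K\subseteq[n]$ (not known in advance); jobs are revealed in order $1,\dots,n$, and on revelation of job $j$ the algorithm learns $p_j$ and which scenarios contain $j$, and must irrevocably assign $j$ to a machine $\tau(j)\in[m]$. With $J_i=\tau^{ -1}(i)$ and $p(S)=\sum_{j\in S}p_j$, the makespan is $\max_{k}\max_i p(J_i\cap S_k)$; for a partial schedule of jobs $1,\dots,j-1$, machine $i'$ attains the makespan if $\max_k p(J_{i'}\cap S_k\cap[j-1])=\max_{k,i}p(J_i\cap S_k\cap[j-1])$. An algorithm is $r$-competitive if its makespan is always at most $r$ times the offline optimum (minimum makespan over all partitions of $[n]$ into $m$ machines). -}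

module Defs where

open import Data.Bool using (Bool; true; false; if_then_else_)
open import Data.Fin using (Fin; zero; suc)
open import Data.List using (List; []; _∷_; _++_; [_]; foldr; map; concatMap)
open import Data.Nat using (ℕ)
open import Data.Product using (_×_; _,_; proj₁; proj₂)
open import Data.Rational using (ℚ; 0ℚ; _+_; _*_; _⊔_; _⊓_; _≤_)
open import Relation.Binary.PropositionalEquality using (_≡_)

-- Two machines: Fin 2 (zero = machine 1, suc zero = machine 2).
Machine : Set
Machine = Fin 2

other : Machine → Machine
other zero = suc zero
other (suc _) = zero

record Job : Set where
  constructor job
  field
    time : ℚ
    inS₁ : Bool
    inS₂ : Bool
open Job public

Scenario : Set
Scenario = Fin 2

inScen : Scenario → Job → Bool
inScen zero j = inS₁ j
inScen (suc _) j = inS₂ j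

data NonNegJobs : List Job → Set where
  []  : NonNegJobs []
  _∷_ : ∀ {j js} → 0ℚ ≤ time j → NonNegJobs js → NonNegJobs (j ∷ js)

-- A (partial) schedule: jobs in revelation order with the machine each got.
Schedule : Set
Schedule = List (Job × Machine)

sameMachine : Machine → Machine → Bool
sameMachine zero zero = true
sameMachine (suc _) (suc _) = true
sameMachine _ _ = false

load : Schedule → Machine → Scenario → ℚ
load [] i k = 0ℚ
load ((j , i') ∷ s) i k =
  (if sameMachine i' i then (if inScen k j then time j else 0ℚ) else 0ℚ) + load s i k

machineMax : Schedule → Machine → ℚ
machineMax s i = load s i zero ⊔ load s i (suc zero)

makespan : Schedule → ℚ
makespan s = machineMax s zero ⊔ machineMax s (suc zero)

-- Deterministic online algorithm: from the previously revealed jobs (in order)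
-- and the newly revealed job, choose a machine.  (Its own earlier decisions are
-- a function of the history, so they need not be an input.)
OnlineAlg : Set
OnlineAlg = List Job → Job → Machine

runFrom : OnlineAlg → List Job → List Job → Schedule
runFrom A prev [] = []
runFrom A prev (j ∷ js) = (j , A prev j) ∷ runFrom A (prev ++ [ j ]) js

run : OnlineAlg → List Job → Schedule
run A js = runFrom A [] js

zipAssign : List Job → List Machine → Schedule
zipAssign [] _ = []
zipAssign (_ ∷ _) [] = []
zipAssign (j ∷ js) (i ∷ is) = (j , i) ∷ zipAssign js is

allAssignments : ℕ → List (List Machine)
allAssignments ℕ.zero = [] ∷ []
allAssignments (ℕ.suc n) =
  concatMap (λ as → (zero ∷ as) ∷ (suc zero ∷ as) ∷ []) (allAssignments n)

lengthJ : List Job → ℕ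
lengthJ [] = ℕ.zero
lengthJ (_ ∷ js) = ℕ.suc (lengthJ js)

minimumFrom : ℚ → List ℚ → ℚ
minimumFrom x xs = foldr _⊓_ x xs

-- offline optimum: minimum makespan over all partitions of the jobs
-- (the list of assignments is nonempty; the all-machine-1 assignment is the seed)
allOnFirst : List Job → List Machine
allOnFirst [] = []
allOnFirst (_ ∷ js) = zero ∷ allOnFirst js

opt : List Job → ℚ
opt js = minimumFrom (makespan (zipAssign js (allOnFirst js)))
                     (map (λ as → makespan (zipAssign js as)) (allAssignments (lengthJ js)))

Competitive : ℚ → OnlineAlg → Set
Competitive r A = (js : List Job) → NonNegJobs js → makespan (run A js) ≤ r * opt js

lastMachine : Schedule → Machine
lastMachine [] = zero
lastMachine ((_ , i) ∷ []) = i
lastMachine (_ ∷ s@(_ ∷ _)) = lastMachine s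

FollowsRule : OnlineAlg → Set
FollowsRule A =
  (prev : List Job) → NonNegJobs prev → (j : Job) → 0ℚ ≤ time j →
  inS₁ j ≡ true → inS₂ j ≡ true →
  let s = run A prev ; i = A prev j in
  (machineMax s (other i) ≡ makespan s) ×
  (machineMax s i ≡ makespan s → i ≡ lastMachine s)

-- The adversary first reveals two unit jobs of S₁ only; stacking them costs
-- ratio 2, so they are split.  Next comes a job of size 2 in S₂ only: the machine
-- taking it is then the unique one attaining the makespan 2, so the rule sends the
-- following shared unit job to the other machine, after which both machines attain
-- makespan 2.  The tie-break then sends a shared job of size 3 to the machine that
-- got the shared unit job, whose S₁-load becomes 1 + 1 + 3 = 5, while the optimum
-- is 3 (the shared job of size 3 alone on one machine).
module Submission where

open import Defs
open import Data.Rational using (ℚ; _<_; _/_)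
open import Data.Integer using (+_)
open import Data.Product using (_×_; Σ)
open import Relation.Nullary using (¬_)

open import Data.Bool using (true; false)
open import Data.Fin using (zero; suc)
open import Data.Nat using (ℕ)
open import Data.List using (List; []; _∷_; take)
open import Data.Product using (_,_; proj₁; proj₂)
open import Data.Rational using (0ℚ; 1ℚ; _≤_; _*_; _≤?_; Positive)
open import Data.Rational.Properties using (*-monoˡ-<-pos; <-≤-trans; ≤-trans; <-irrefl)
open import Relation.Binary.PropositionalEquality using (_≡_; _≢_; refl)
open import Relation.Nullary.Decidable using (from-yes)

private
  variable
    i i₁ i₂ i₃ i₄ : Machine

≢⇒≡other : i₁ ≢ i₂ → i₁ ≡ other i₂
≢⇒≡other {zero}     {zero}     i₁≢i₂ with () ← i₁≢i₂ refl
≢⇒≡other {zero}     {suc zero} _     = refl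
≢⇒≡other {suc zero} {zero}     _     = refl
≢⇒≡other {suc zero} {suc zero} i₁≢i₂ with () ← i₁≢i₂ refl

other-≢⇒≡ : other i₁ ≢ i₂ → i₁ ≡ i₂
other-≢⇒≡ {zero}     {zero}     _       = refl
other-≢⇒≡ {zero}     {suc zero} other≢i with () ← other≢i refl
other-≢⇒≡ {suc zero} {zero}     other≢i with () ← other≢i refl
other-≢⇒≡ {suc zero} {suc zero} _       = refl

ratio-refutes : ∀ {r ρ p q} .{{_ : Positive q}} → r < ρ → ρ * q ≤ p → ¬ (p ≤ r * q)
ratio-refutes {q = q} r<ρ ρq≤p p≤rq =
  <-irrefl refl (<-≤-trans (*-monoˡ-<-pos q r<ρ) (≤-trans ρq≤p p≤rq))

NonNegJobs-take : ∀ n {js} → NonNegJobs js → NonNegJobs (take n js)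
NonNegJobs-take ℕ.zero    _         = []
NonNegJobs-take (ℕ.suc n) []        = []
NonNegJobs-take (ℕ.suc n) (0≤ ∷ nn) = 0≤ ∷ NonNegJobs-take n nn

module _ {A : OnlineAlg} (rule : FollowsRule A) {prev : List Job} (nn : NonNegJobs prev)
         {j : Job} (0≤j : 0ℚ ≤ time j) (j∈S₁ : inS₁ j ≡ true) (j∈S₂ : inS₂ j ≡ true) where

  private
    s : Schedule
    s = run A prev

  shared-job-to-non-attainer : machineMax s i ≢ makespan s → A prev j ≡ i
  shared-job-to-non-attainer i-below =
    other-≢⇒≡ λ { refl → i-below (proj₁ (rule prev nn j 0≤j j∈S₁ j∈S₂)) }

  shared-job-at-tie : (∀ i → machineMax s i ≡ makespan s) → A prev j ≡ lastMachine s
  shared-job-at-tie tie = proj₂ (rule prev nn j 0≤j j∈S₁ j∈S₂) (tie (A prev j))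

j₁ j₂ j₃ j₄ j₅ : Job
j₁ = job 1ℚ true false
j₂ = job 1ℚ true false
j₃ = job (+ 2 / 1) false true
j₄ = job 1ℚ true true
j₅ = job (+ 3 / 1) true true

adversary : List Job
adversary = j₁ ∷ j₂ ∷ j₃ ∷ j₄ ∷ j₅ ∷ []

0≤1 : 0ℚ ≤ 1ℚ
0≤1 = from-yes (0ℚ ≤? 1ℚ)

0≤3 : 0ℚ ≤ + 3 / 1
0≤3 = from-yes (0ℚ ≤? + 3 / 1)

adversary-nonNeg : NonNegJobs adversary
adversary-nonNeg = 0≤1 ∷ 0≤1 ∷ from-yes (0ℚ ≤? + 2 / 1) ∷ 0≤1 ∷ 0≤3 ∷ []

stacked-ratio : i₂ ≡ i₁ → + 5 / 3 * opt (take 2 adversary) ≤ makespan ((j₁ , i₁) ∷ (j₂ , i₂) ∷ [])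
stacked-ratio {i₁ = zero}     refl = from-yes (+ 5 / 3 * 1ℚ ≤? + 2 / 1)
stacked-ratio {i₁ = suc zero} refl = from-yes (+ 5 / 3 * 1ℚ ≤? + 2 / 1)

j₃-sole-attainer : i₂ ≡ other i₁ → ∀ i₃ →
  let s = (j₁ , i₁) ∷ (j₂ , i₂) ∷ (j₃ , i₃) ∷ [] in machineMax s (other i₃) ≢ makespan s
j₃-sole-attainer {i₁ = zero}     refl zero       ()
j₃-sole-attainer {i₁ = zero}     refl (suc zero) ()
j₃-sole-attainer {i₁ = suc zero} refl zero       ()
j₃-sole-attainer {i₁ = suc zero} refl (suc zero) ()

j₄-ties : i₂ ≡ other i₁ → i₄ ≡ other i₃ →
  let s = (j₁ , i₁) ∷ (j₂ , i₂) ∷ (j₃ , i₃) ∷ (j₄ , i₄) ∷ [] in ∀ i → machineMax s i ≡ makespan s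
j₄-ties {i₁ = zero}     {i₃ = zero}     refl refl = λ { zero → refl ; (suc zero) → refl }
j₄-ties {i₁ = zero}     {i₃ = suc zero} refl refl = λ { zero → refl ; (suc zero) → refl }
j₄-ties {i₁ = suc zero} {i₃ = zero}     refl refl = λ { zero → refl ; (suc zero) → refl }
j₄-ties {i₁ = suc zero} {i₃ = suc zero} refl refl = λ { zero → refl ; (suc zero) → refl }

forced-ratio : ∀ {i₅} → i₂ ≡ other i₁ → i₄ ≡ other i₃ → i₅ ≡ i₄ →
  + 5 / 3 * opt adversary ≤
    makespan ((j₁ , i₁) ∷ (j₂ , i₂) ∷ (j₃ , i₃) ∷ (j₄ , i₄) ∷ (j₅ , i₅) ∷ [])
forced-ratio {i₁ = zero}     {i₃ = zero}     refl refl refl = from-yes (+ 5 / 3 * (+ 3 / 1) ≤? + 5 / 1)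
forced-ratio {i₁ = zero}     {i₃ = suc zero} refl refl refl = from-yes (+ 5 / 3 * (+ 3 / 1) ≤? + 5 / 1)
forced-ratio {i₁ = suc zero} {i₃ = zero}     refl refl refl = from-yes (+ 5 / 3 * (+ 3 / 1) ≤? + 5 / 1)
forced-ratio {i₁ = suc zero} {i₃ = suc zero} refl refl refl = from-yes (+ 5 / 3 * (+ 3 / 1) ≤? + 5 / 1)

mainTheorem8 : (r : ℚ) → r < (+ 5) / 3 →
    ¬ (Σ OnlineAlg λ A → Competitive r A × FollowsRule A)
mainTheorem8 r r<5/3 (A , competitive , rule) =
  ratio-refutes r<5/3 (forced-ratio j₁-j₂-split j₄-avoids-j₃ j₅-follows-j₄)
    (competitive adversary adversary-nonNeg)
  where
  prefix-nonNeg : ∀ n → NonNegJobs (take n adversary)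
  prefix-nonNeg n = NonNegJobs-take n adversary-nonNeg

  j₁-j₂-split : A (j₁ ∷ []) j₂ ≡ other (A [] j₁)
  j₁-j₂-split = ≢⇒≡other λ stacked →
    ratio-refutes r<5/3 (stacked-ratio stacked) (competitive (take 2 adversary) (prefix-nonNeg 2))

  j₄-avoids-j₃ : A (take 3 adversary) j₄ ≡ other (A (take 2 adversary) j₃)
  j₄-avoids-j₃ = shared-job-to-non-attainer rule (prefix-nonNeg 3) 0≤1 refl refl
    (j₃-sole-attainer j₁-j₂-split _)

  j₅-follows-j₄ : A (take 4 adversary) j₅ ≡ A (take 3 adversary) j₄
  j₅-follows-j₄ = shared-job-at-tie rule (prefix-nonNeg 4) 0≤3 refl refl
    (j₄-ties j₁-j₂-split j₄-avoids-j₃)
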